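{- Let $E$ be a $(k+1)$-crossing-free set of edges and let $R$ and $S$ be two $k$-stars contained in $E$. \begin{enumerate} \item Any angle of $S$ (or $R$) is also an angle of $E$ and is $k$-relevant. \item For any vertex $t$ not in $S$, there is a unique angle $\angle(u,v,w)$ in $S$ that is bisected by $[v,t]$. \end{enumerate}
   Context: Vertices of a convex $n$-gon ($n\ge2k+1$) lie on the unit circle, labelled counterclockwise by $\mathbb{Z}_n$; $u\prec v\prec w$ denotes counterclockwise order. The length of edge $[u,v]$ is $\min(|\{w: u\preccurlyeq w\prec v\}|,|\{w: v\preccurlyeq w\prec u\}|)$; it is $k$-relevant if the length exceeds $k$ and a $k$-boundary edge if it equals $k$. Edges cross if their open segments intersect; an $\ell$-crossing is a set of $\ell$ mutually crossing edges. A $k$-star is a set of edges $\{[s_j,s_{j+k}]: j\in\mathbb{Z}_{2k+1}\}$ with $s_0\prec\dots\prec s_{2k}\prec s_0$. An angle $\angle(u,v,w)$ of an edge set $F$ is a pair $\{[u,v],[v,w]\}\subseteq F$ with $u\prec v\prec w$ such that no edge $[v,t]$ with $w\prec t\prec u$ belongs to $F$; for such $t$, $[v,t]$ is a bisector of the angle. An angle is $k$-relevant if both its edges are $k$-relevant or $k$-boundary edges. Angles of $S$ are angles of $S$ viewed as an edge set. -}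

module Defs where

open import Data.Nat using (ℕ; zero; suc; _+_; _*_; _∸_; _≤_; _<_; _⊔_; _⊓_)
open import Data.Nat.DivMod using (_%_; _mod_)
open import Data.Fin using (Fin; toℕ)
open import Data.Product using (Σ; ∃; _×_; _,_)
open import Data.Sum using (_⊎_)
open import Relation.Binary.PropositionalEquality using (_≡_; _≢_)
open import Relation.Nullary using (¬_)

-- Vertices of the convex n-gon are Fin n (= ℤ_n), labelled counterclockwise.
-- Counterclockwise (cyclic) strict order  u ≺ v ≺ w.
Cyc : ∀ {n} → Fin n → Fin n → Fin n → Set
Cyc u v w =
    (toℕ u < toℕ v × toℕ v < toℕ w)
  ⊎ (toℕ v < toℕ w × toℕ w < toℕ u)
  ⊎ (toℕ w < toℕ u × toℕ u < toℕ v)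

-- A set of edges on the vertex set Fin n, given by a relation; the edge
-- [u,v] belongs to F iff F u v or F v u (edges are unordered pairs).
EdgeRel : ℕ → Set₁
EdgeRel n = Fin n → Fin n → Set

_∋[_,_] : ∀ {n} → EdgeRel n → Fin n → Fin n → Set
F ∋[ u , v ] = F u v ⊎ F v u

Loopless : ∀ {n} → EdgeRel n → Set
Loopless {n} F = (u : Fin n) → ¬ F u u

-- |{w : u ≼ w ≺ v}| = (v - u) mod n
arc : ∀ {n} → Fin n → Fin n → ℕ
arc {zero} () _
arc {suc m} u v = (toℕ v + suc m ∸ toℕ u) % suc m

len : ∀ {n} → Fin n → Fin n → ℕ
len u v = arc u v ⊓ arc v u

RelOrBoundary : ∀ {n} → ℕ → Fin n → Fin n → Set
RelOrBoundary k u v = k ≤ len u v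

-- open segments of chords [a,b] and [c,d] intersect (convex position):
-- endpoints interleave on the circle.
Cross : ∀ {n} → Fin n → Fin n → Fin n → Fin n → Set
Cross a b c d = (Cyc a c b × Cyc b d a) ⊎ (Cyc a d b × Cyc b c a)

-- F contains an ℓ-crossing: ℓ edges of F, mutually crossing
-- (mutually crossing edges are automatically pairwise distinct).
HasCrossing : ∀ {n} → ℕ → EdgeRel n → Set
HasCrossing {n} ℓ F =
  Σ (Fin ℓ → Fin n) λ a → Σ (Fin ℓ → Fin n) λ b →
    ((i : Fin ℓ) → F ∋[ a i , b i ]) ×
    ((i j : Fin ℓ) → i ≢ j → Cross (a i) (b i) (a j) (b j))

CrossingFree : ∀ {n} → ℕ → EdgeRel n → Set
CrossingFree ℓ F = ¬ HasCrossing ℓ F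

shift : (k : ℕ) → Fin (suc (2 * k)) → Fin (suc (2 * k))
shift k j = (toℕ j + k) mod suc (2 * k)

CyclicChain : ∀ {n m} → (Fin m → Fin n) → Set
CyclicChain {n} {m} s =
  (i j l : Fin m) → toℕ i < toℕ j → toℕ j < toℕ l → Cyc (s i) (s j) (s l)

StarEdges : ∀ {n} (k : ℕ) → (Fin (suc (2 * k)) → Fin n) → EdgeRel n
StarEdges k s u v = Σ (Fin (suc (2 * k))) λ j → (s j ≡ u) × (s (shift k j) ≡ v)

StarIn : ∀ {n} (k : ℕ) → (Fin (suc (2 * k)) → Fin n) → EdgeRel n → Set
StarIn k s E = (j : Fin (suc (2 * k))) → E ∋[ s j , s (shift k j) ]

Angle : ∀ {n} → EdgeRel n → Fin n → Fin n → Fin n → Set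
Angle {n} F u v w =
  Cyc u v w × F ∋[ u , v ] × F ∋[ v , w ] ×
  ((t : Fin n) → Cyc w t u → ¬ (F ∋[ v , t ]))

Bisects : ∀ {n} → Fin n → Fin n → Fin n → Fin n → Set
Bisects u v w t = Cyc w t u

RelevantAngle : ∀ {n} → ℕ → Fin n → Fin n → Fin n → Set
RelevantAngle k u v w = RelOrBoundary k u v × RelOrBoundary k v w

Part1 : ∀ {n} (k : ℕ) → EdgeRel n → (Fin (suc (2 * k)) → Fin n) → Set
Part1 {n} k E s = (u v w : Fin n) → Angle (StarEdges k s) u v w →
  Angle E u v w × RelevantAngle k u v w

Part2 : ∀ {n} (k : ℕ) → (Fin (suc (2 * k)) → Fin n) → Set
Part2 {n} k s = (t : Fin n) → ((j : Fin (suc (2 * k))) → s j ≢ t) →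
  Σ (Fin n) λ u → Σ (Fin n) λ v → Σ (Fin n) λ w →
    (Angle (StarEdges k s) u v w × Bisects u v w t) ×
    ((u' v' w' : Fin n) → Angle (StarEdges k s) u' v' w' → Bisects u' v' w' t →
       (u' ≡ u × v' ≡ v × w' ≡ w))

-- The vertices s₀ ≺ … ≺ s_{2k} of a k-star are extended periodically to a
-- sequence S : ℕ → Fin n of period m = 2k+1, so that the star edges are
-- [S a, S (a+k)].  Every vertex S a has exactly the two star neighbours
-- S (a+k) ≺ S (a+k+1), hence the angles of the star are exactly the
-- ∠(S (a+k+1), S a, S (a+k)).
--
-- Part 1.  Such an angle spans ≥ k steps of the star on both sides, so its
-- edges have length ≥ k.  It is also an angle of E: an E-edge [S a, t] with
-- t strictly between S (a+k) and S (a+k+1) would cross the k star edges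
-- [S (a+i), S (a+i+k)], 1 ≤ i ≤ k, which cross pairwise -- a (k+1)-crossing.
--
-- Part 2.  A vertex t outside the star lies in exactly one "gap"
-- S i ≺ t ≺ S (i+1) (existence by walking around the star, uniqueness since
-- two gaps would place t on both sides of a chord); the angles whose bisector
-- region contains t correspond exactly to the gaps, via i = a + k.
module Submission where

open import Defs
open import Data.Nat using (ℕ; zero; suc; _+_; _*_; _∸_; _≤_; _<_; z≤n; s≤s; _<?_; NonZero)
open import Data.Nat.Properties
open import Data.Nat.DivMod using (_%_; _mod_; [m+n]%n≡m%n; m<n⇒m%n≡m; %-distribˡ-+; m%n%n≡m%n; m%n<n)
open import Data.Nat.Tactic.RingSolver using (solve-∀)
open import Data.Fin using (Fin; toℕ) renaming (zero to fzero; suc to fsuc)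
open import Data.Fin.Properties using (toℕ-injective; toℕ-fromℕ<; toℕ<n)
open import Data.Product using (∃; _×_; _,_; proj₁)
open import Data.Sum using (_⊎_; inj₁; inj₂; swap)
open import Data.Empty using (⊥; ⊥-elim)
open import Relation.Nullary using (¬_; yes; no)
open import Relation.Binary using (tri<; tri≈; tri>)
open import Relation.Binary.PropositionalEquality

<-witness : ∀ {x y} → x < y → ∃ λ e → y ≡ x + suc e
<-witness {x} x<y with m≤n⇒∃[o]m+o≡n x<y
... | e , x+1+e≡y = e , trans (sym x+1+e≡y) (sym (+-suc x e))

CycN : ℕ → ℕ → ℕ → Set
CycN a b c = (a < b × b < c) ⊎ (b < c × c < a) ⊎ (c < a × a < b)

CycN-resp : ∀ {a b c a′ b′ c′} → a ≡ a′ → b ≡ b′ → c ≡ c′ → CycN a b c → CycN a′ b′ c′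
CycN-resp refl refl refl abc = abc

module _ {n : ℕ} where

  cyc-rotate : {a b c : Fin n} → Cyc a b c → Cyc b c a
  cyc-rotate (inj₁ p) = inj₂ (inj₂ p)
  cyc-rotate (inj₂ (inj₁ p)) = inj₁ p
  cyc-rotate (inj₂ (inj₂ p)) = inj₂ (inj₁ p)

  cyc-asym : {a b c : Fin n} → Cyc a b c → ¬ Cyc a c b
  cyc-asym (inj₁ (_ , bc)) (inj₁ (_ , cb)) = <-asym bc cb
  cyc-asym (inj₁ (_ , bc)) (inj₂ (inj₁ (cb , _))) = <-asym bc cb
  cyc-asym (inj₁ (ab , _)) (inj₂ (inj₂ (ba , _))) = <-asym ab ba
  cyc-asym (inj₂ (inj₁ (_ , ca))) (inj₁ (ac , _)) = <-asym ca ac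
  cyc-asym (inj₂ (inj₁ (bc , _))) (inj₂ (inj₁ (cb , _))) = <-asym bc cb
  cyc-asym (inj₂ (inj₁ (_ , ca))) (inj₂ (inj₂ (_ , ac))) = <-asym ca ac
  cyc-asym (inj₂ (inj₂ (ca , _))) (inj₁ (ac , _)) = <-asym ca ac
  cyc-asym (inj₂ (inj₂ (_ , ab))) (inj₂ (inj₁ (_ , ba))) = <-asym ab ba
  cyc-asym (inj₂ (inj₂ (_ , ab))) (inj₂ (inj₂ (ba , _))) = <-asym ab ba

  cyc-trans : {a b c d : Fin n} → Cyc a b c → Cyc a c d → Cyc a b d
  cyc-trans (inj₁ (ab , bc)) (inj₁ (_ , cd)) = inj₁ (ab , <-trans bc cd)
  cyc-trans (inj₁ (ab , bc)) (inj₂ (inj₁ (cd , da))) = ⊥-elim (<-asym (<-trans ab bc) (<-trans cd da))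
  cyc-trans (inj₁ (ab , _)) (inj₂ (inj₂ (da , _))) = inj₂ (inj₂ (da , ab))
  cyc-trans (inj₂ (inj₁ (_ , ca))) (inj₁ (ac , _)) = ⊥-elim (<-asym ca ac)
  cyc-trans (inj₂ (inj₁ (bc , _))) (inj₂ (inj₁ (cd , da))) = inj₂ (inj₁ (<-trans bc cd , da))
  cyc-trans (inj₂ (inj₁ (_ , ca))) (inj₂ (inj₂ (_ , ac))) = ⊥-elim (<-asym ca ac)
  cyc-trans (inj₂ (inj₂ (ca , _))) (inj₁ (ac , _)) = ⊥-elim (<-asym ca ac)
  cyc-trans (inj₂ (inj₂ (_ , ab))) (inj₂ (inj₁ (_ , da))) = inj₂ (inj₂ (da , ab))
  cyc-trans (inj₂ (inj₂ (ca , _))) (inj₂ (inj₂ (_ , ac))) = ⊥-elim (<-asym ca ac)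

  cyc-trans′ : {a b c d : Fin n} → Cyc a b c → Cyc a c d → Cyc b c d
  cyc-trans′ abc acd = cyc-rotate (cyc-rotate (cyc-trans (cyc-rotate acd) (cyc-rotate (cyc-rotate abc))))

  cyc-irrefl₁₂ : {a c : Fin n} → ¬ Cyc a a c
  cyc-irrefl₁₂ (inj₁ (aa , _)) = <-irrefl refl aa
  cyc-irrefl₁₂ (inj₂ (inj₁ (ac , ca))) = <-asym ac ca
  cyc-irrefl₁₂ (inj₂ (inj₂ (_ , aa))) = <-irrefl refl aa

  cyc-irrefl₂₃ : {a b : Fin n} → ¬ Cyc a b b
  cyc-irrefl₂₃ abb = cyc-irrefl₁₂ (cyc-rotate abb)

  cyc-irrefl₁₃ : {a b : Fin n} → ¬ Cyc a b a
  cyc-irrefl₁₃ aba = cyc-irrefl₁₂ (cyc-rotate (cyc-rotate aba))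

  cyc-distinct₁₂ : {a b c : Fin n} → Cyc a b c → a ≢ b
  cyc-distinct₁₂ abc refl = cyc-irrefl₁₂ abc

  cyc-distinct₂₃ : {a b c : Fin n} → Cyc a b c → b ≢ c
  cyc-distinct₂₃ abc refl = cyc-irrefl₂₃ abc

  cyc-distinct₁₃ : {a b c : Fin n} → Cyc a b c → a ≢ c
  cyc-distinct₁₃ abc refl = cyc-irrefl₁₃ abc

  cyc-total : {a b c : Fin n} → a ≢ b → b ≢ c → a ≢ c → Cyc a b c ⊎ Cyc a c b
  cyc-total {a} {b} {c} a≢b b≢c a≢c with <-cmp (toℕ a) (toℕ b) | <-cmp (toℕ b) (toℕ c) | <-cmp (toℕ a) (toℕ c)
  ... | tri≈ _ e _ | _ | _ = ⊥-elim (a≢b (toℕ-injective e))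
  ... | _ | tri≈ _ e _ | _ = ⊥-elim (b≢c (toℕ-injective e))
  ... | _ | _ | tri≈ _ e _ = ⊥-elim (a≢c (toℕ-injective e))
  ... | tri< ab _ _ | tri< bc _ _ | tri< _ _ _ = inj₁ (inj₁ (ab , bc))
  ... | tri< ab _ _ | tri< bc _ _ | tri> _ _ ca = ⊥-elim (<-asym (<-trans ab bc) ca)
  ... | tri< _ _ _ | tri> _ _ cb | tri< ac _ _ = inj₂ (inj₁ (ac , cb))
  ... | tri< ab _ _ | tri> _ _ _ | tri> _ _ ca = inj₁ (inj₂ (inj₂ (ca , ab)))
  ... | tri> _ _ ba | tri< _ _ _ | tri< ac _ _ = inj₂ (inj₂ (inj₂ (ba , ac)))
  ... | tri> _ _ _ | tri< bc _ _ | tri> _ _ ca = inj₁ (inj₂ (inj₁ (bc , ca)))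
  ... | tri> _ _ ba | tri> _ _ cb | tri< ac _ _ = ⊥-elim (<-asym (<-trans cb ba) ac)
  ... | tri> _ _ ba | tri> _ _ cb | tri> _ _ _ = inj₂ (inj₂ (inj₁ (cb , ba)))

  cross-sym : {a b c d : Fin n} → Cross a b c d → Cross c d a b
  cross-sym (inj₁ (acb , bda)) = inj₂ (cyc-rotate (cyc-rotate (cyc-trans bda (cyc-rotate (cyc-rotate acb))))
                                      , cyc-trans′ bda (cyc-rotate (cyc-rotate acb)))
  cross-sym (inj₂ (adb , bca)) = inj₁ (cyc-trans′ bca (cyc-rotate (cyc-rotate adb))
                                      , cyc-rotate (cyc-rotate (cyc-trans bca (cyc-rotate (cyc-rotate adb)))))

chain-cyc : ∀ {n m} {s : Fin m → Fin n} → CyclicChain s →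
  (i j l : Fin m) → CycN (toℕ i) (toℕ j) (toℕ l) → Cyc (s i) (s j) (s l)
chain-cyc chain i j l (inj₁ (i<j , j<l)) = chain i j l i<j j<l
chain-cyc chain i j l (inj₂ (inj₁ (j<l , l<i))) = cyc-rotate (cyc-rotate (chain j l i j<l l<i))
chain-cyc chain i j l (inj₂ (inj₂ (l<i , i<j))) = cyc-rotate (chain l i j l<i i<j)

module _ {N : ℕ} where

  arc-forward : (u v : Fin (suc N)) (e : ℕ) → toℕ v ≡ toℕ u + e → arc u v ≡ e
  arc-forward u v e v≡u+e = begin
      (toℕ v + suc N ∸ toℕ u) % suc N  ≡⟨ cong (λ z → (z + suc N ∸ toℕ u) % suc N) v≡u+e ⟩
      (toℕ u + e + suc N ∸ toℕ u) % suc N  ≡⟨ cong (λ z → (z ∸ toℕ u) % suc N) (+-assoc (toℕ u) e (suc N)) ⟩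
      (toℕ u + (e + suc N) ∸ toℕ u) % suc N  ≡⟨ cong (_% suc N) (m+n∸m≡n (toℕ u) (e + suc N)) ⟩
      (e + suc N) % suc N  ≡⟨ [m+n]%n≡m%n e (suc N) ⟩
      e % suc N  ≡⟨ m<n⇒m%n≡m e<N ⟩
      e  ∎
    where
    open ≡-Reasoning
    e<N : e < suc N
    e<N = ≤-<-trans (subst (e ≤_) (sym v≡u+e) (m≤n+m e (toℕ u))) (toℕ<n v)

  arc-backward : (u v : Fin (suc N)) (e f : ℕ) → toℕ u ≡ toℕ v + suc e → suc N ≡ toℕ u + f →
    arc u v ≡ toℕ v + f
  arc-backward u v e f u≡v+1+e N≡u+f = begin
      (toℕ v + suc N ∸ toℕ u) % suc N  ≡⟨ cong (λ z → (toℕ v + z ∸ toℕ u) % suc N) N≡u+f ⟩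
      (toℕ v + (toℕ u + f) ∸ toℕ u) % suc N  ≡⟨ cong (λ z → (z ∸ toℕ u) % suc N) (swap-sum (toℕ v) (toℕ u) f) ⟩
      (toℕ u + (toℕ v + f) ∸ toℕ u) % suc N  ≡⟨ cong (_% suc N) (m+n∸m≡n (toℕ u) (toℕ v + f)) ⟩
      (toℕ v + f) % suc N  ≡⟨ m<n⇒m%n≡m v+f<N ⟩
      toℕ v + f  ∎
    where
    open ≡-Reasoning
    swap-sum : ∀ a b c → a + (b + c) ≡ b + (a + c)
    swap-sum = solve-∀
    regroup : ∀ a e f → a + suc e + f ≡ suc (a + f) + e
    regroup = solve-∀
    v+f<N : toℕ v + f < suc N
    v+f<N = subst (suc (toℕ v + f) ≤_)
      (sym (trans N≡u+f (trans (cong (_+ f) u≡v+1+e) (regroup (toℕ v) e f)))) (m≤m+n _ e)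

  to-end : (u : Fin (suc N)) → ∃ λ f → suc N ≡ toℕ u + suc f
  to-end u = <-witness (toℕ<n u)

arc-positive : ∀ {n} {a b : Fin n} → a ≢ b → 1 ≤ arc a b
arc-positive {suc N} {a} {b} a≢b with <-cmp (toℕ a) (toℕ b)
... | tri≈ _ a≡b _ = ⊥-elim (a≢b (toℕ-injective a≡b))
... | tri< a<b _ _ with <-witness a<b
...   | e , b≡a+1+e = subst (1 ≤_) (sym (arc-forward a b (suc e) b≡a+1+e)) (s≤s z≤n)
arc-positive {suc N} {a} {b} a≢b | tri> _ _ b<a with <-witness b<a | to-end a
...   | e , a≡b+1+e | f , N≡a+1+f = subst (1 ≤_) (sym (arc-backward a b e (suc f) a≡b+1+e N≡a+1+f))
                                      (subst (1 ≤_) (sym (+-suc (toℕ b) f)) (s≤s z≤n))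

arc-additive : ∀ {n} {a b c : Fin n} → Cyc a b c → arc a c ≡ arc a b + arc b c
arc-additive {suc N} {a} {b} {c} (inj₁ (a<b , b<c)) with <-witness a<b | <-witness b<c
... | x , b≡ | y , c≡ =
  trans (arc-forward a c (suc x + suc y) (trans c≡ (trans (cong (_+ suc y) b≡) (+-assoc (toℕ a) (suc x) (suc y)))))
        (sym (cong₂ _+_ (arc-forward a b (suc x) b≡) (arc-forward b c (suc y) c≡)))
arc-additive {suc N} {a} {b} {c} (inj₂ (inj₁ (b<c , c<a))) with <-witness b<c | <-witness c<a | to-end a
... | x , c≡ | y , a≡ | f , N≡ =
  trans (arc-backward a c y (suc f) a≡ N≡)
    (trans (trans (cong (_+ suc f) c≡) (regroup (toℕ b) x (suc f)))
      (sym (cong₂ _+_ (arc-backward a b (x + suc y) (suc f)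
                        (trans a≡ (trans (cong (_+ suc y) c≡) (+-assoc (toℕ b) (suc x) (suc y)))) N≡)
                      (arc-forward b c (suc x) c≡))))
  where
  regroup : ∀ b x f → b + suc x + f ≡ b + f + suc x
  regroup = solve-∀
arc-additive {suc N} {a} {b} {c} (inj₂ (inj₂ (c<a , a<b))) with <-witness c<a | <-witness a<b | to-end b
... | x , a≡ | y , b≡ | f , N≡ =
  trans (arc-backward a c x (suc y + suc f) a≡ (trans N≡ (trans (cong (_+ suc f) b≡) (+-assoc (toℕ a) (suc y) (suc f)))))
    (trans (regroup (toℕ c) y (suc f))
      (sym (cong₂ _+_ (arc-forward a b (suc y) b≡)
                      (arc-backward b c (x + suc y) (suc f)
                        (trans b≡ (trans (cong (_+ suc y) a≡) (+-assoc (toℕ c) (suc x) (suc y)))) N≡))))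
  where
  regroup : ∀ c y f → c + (suc y + f) ≡ suc y + (c + f)
  regroup = solve-∀

module _ {m : ℕ} .{{_ : NonZero m}} where

  residue-shift : ∀ x {d} → d < m → (x % m + d) % m ≡ (x + d) % m
  residue-shift x {d} d<m = begin
      (x % m + d) % m  ≡⟨ cong (λ z → (x % m + z) % m) (sym (m<n⇒m%n≡m d<m)) ⟩
      (x % m + d % m) % m  ≡⟨ sym (%-distribˡ-+ x d m) ⟩
      (x + d) % m  ∎
    where open ≡-Reasoning

  overflow : ∀ {r d} → r < m → d < m → m ≤ r + d → ∃ λ o → (r + d) % m ≡ o × m + o ≡ r + d × o < r
  overflow {r} {d} r<m d<m m≤r+d with m≤n⇒∃[o]m+o≡n m≤r+d
  ... | o , m+o≡r+d = o , residue , m+o≡r+d , o<r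
    where
    o<r : o < r
    o<r = +-cancelˡ-< m o r (subst (_< m + r) (sym m+o≡r+d) (subst (r + d <_) (+-comm r m) (+-monoʳ-< r d<m)))
    residue : (r + d) % m ≡ o
    residue = begin
      (r + d) % m  ≡⟨ cong (_% m) (trans (sym m+o≡r+d) (+-comm m o)) ⟩
      (o + m) % m  ≡⟨ [m+n]%n≡m%n o m ⟩
      o % m  ≡⟨ m<n⇒m%n≡m (<-trans o<r r<m) ⟩
      o  ∎
      where open ≡-Reasoning

  offsets-cyclic : ∀ {r d₁ d₂} → r < m → 0 < d₁ → d₁ < d₂ → d₂ < m → CycN r ((r + d₁) % m) ((r + d₂) % m)
  offsets-cyclic {r} {d₁} {d₂} r<m 0<d₁ d₁<d₂ d₂<m with r + d₂ <? m | r + d₁ <? m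
  ... | yes r+d₂<m | _ =
    inj₁ (subst (r <_) (sym p₁) (m<m+n r 0<d₁) , subst₂ _<_ (sym p₁) (sym p₂) (+-monoʳ-< r d₁<d₂))
    where
    p₁ : (r + d₁) % m ≡ r + d₁
    p₁ = m<n⇒m%n≡m (<-trans (+-monoʳ-< r d₁<d₂) r+d₂<m)
    p₂ : (r + d₂) % m ≡ r + d₂
    p₂ = m<n⇒m%n≡m r+d₂<m
  ... | no r+d₂≮m | yes r+d₁<m with overflow r<m d₂<m (≮⇒≥ r+d₂≮m)
  ...   | o₂ , p₂ , _ , o₂<r =
    inj₂ (inj₂ (subst (_< r) (sym p₂) o₂<r , subst (r <_) (sym (m<n⇒m%n≡m r+d₁<m)) (m<m+n r 0<d₁)))
  offsets-cyclic {r} {d₁} {d₂} r<m 0<d₁ d₁<d₂ d₂<m | no r+d₂≮m | no r+d₁≮m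
    with overflow r<m d₂<m (≮⇒≥ r+d₂≮m) | overflow r<m (<-trans d₁<d₂ d₂<m) (≮⇒≥ r+d₁≮m)
  ... | o₂ , p₂ , m+o₂≡ , o₂<r | o₁ , p₁ , m+o₁≡ , _ =
    inj₂ (inj₁ (subst₂ _<_ (sym p₁) (sym p₂) o₁<o₂ , subst (_< r) (sym p₂) o₂<r))
    where
    o₁<o₂ : o₁ < o₂
    o₁<o₂ = +-cancelˡ-< m o₁ o₂ (subst₂ _<_ (sym m+o₁≡) (sym m+o₂≡) (+-monoʳ-< r d₁<d₂))

module Star {n : ℕ} (k : ℕ) (s : Fin (suc (2 * k)) → Fin n) (chain : CyclicChain s) (k≥1 : 1 ≤ k) where

  m : ℕ
  m = suc (2 * k)

  k<m : k < m
  k<m = s≤s (m≤m+n k (k + 0))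

  1+k<m : suc k < m
  1+k<m = s≤s (subst (k <_) (sym (cong (k +_) (+-identityʳ k))) (m<m+n k k≥1))

  2<m : 2 < m
  2<m = s≤s (*-monoʳ-≤ 2 k≥1)

  S : ℕ → Fin n
  S x = s (x mod m)

  toℕ-mod : ∀ x → toℕ (x mod m) ≡ x % m
  toℕ-mod x = toℕ-fromℕ< (m%n<n x m)

  S-cong : ∀ x y → x % m ≡ y % m → S x ≡ S y
  S-cong x y x≡y = cong s (toℕ-injective (trans (toℕ-mod x) (trans x≡y (sym (toℕ-mod y)))))

  S-shift : ∀ x y c → x % m ≡ y % m → S (x + c) ≡ S (y + c)
  S-shift x y c x≡y = S-cong (x + c) (y + c)
    (trans (%-distribˡ-+ x c m) (trans (cong (λ z → (z + c % m) % m) x≡y) (sym (%-distribˡ-+ y c m))))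

  S-mod : ∀ x → S x ≡ S (x % m)
  S-mod x = S-cong x (x % m) (sym (m%n%n≡m%n x m))

  S-period : ∀ x y → y ≡ x + m → S y ≡ S x
  S-period x y refl = S-cong (x + m) x ([m+n]%n≡m%n x m)

  S-fin : ∀ j → s j ≡ S (toℕ j)
  S-fin j = cong s (toℕ-injective (sym (trans (toℕ-mod (toℕ j)) (m<n⇒m%n≡m (toℕ<n j)))))

  S-around₁ : ∀ a → S (a + k + suc k) ≡ S a
  S-around₁ a = S-period a _ (regroup a k)
    where
    regroup : ∀ a k → a + k + suc k ≡ a + suc (2 * k)
    regroup = solve-∀

  S-around₂ : ∀ a → S (a + suc k + k) ≡ S a
  S-around₂ a = S-period a _ (regroup a k)
    where
    regroup : ∀ a k → a + suc k + k ≡ a + suc (2 * k)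
    regroup = solve-∀

  one-more : ∀ a → a + suc k ≡ a + k + 1
  one-more a = regroup a k
    where
    regroup : ∀ a k → a + suc k ≡ a + k + 1
    regroup = solve-∀

  S-cyc : ∀ {x y z} → CycN (x % m) (y % m) (z % m) → Cyc (S x) (S y) (S z)
  S-cyc {x} {y} {z} xyz = chain-cyc chain (x mod m) (y mod m) (z mod m)
    (CycN-resp (sym (toℕ-mod x)) (sym (toℕ-mod y)) (sym (toℕ-mod z)) xyz)

  S-ordered : ∀ x d₁ d₂ → 0 < d₁ → d₁ < d₂ → d₂ < m → Cyc (S x) (S (x + d₁)) (S (x + d₂))
  S-ordered x d₁ d₂ 0<d₁ d₁<d₂ d₂<m =
    S-cyc {x} {x + d₁} {x + d₂} (CycN-resp refl (residue-shift x (<-trans d₁<d₂ d₂<m)) (residue-shift x d₂<m)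
      (offsets-cyclic (m%n<n x m) 0<d₁ d₁<d₂ d₂<m))

  neighbours-ordered : ∀ a → Cyc (S a) (S (a + k)) (S (a + suc k))
  neighbours-ordered a = S-ordered a k (suc k) k≥1 (n<1+n k) 1+k<m

  S-distinct : ∀ x d → 0 < d → d < m → S x ≢ S (x + d)
  S-distinct x (suc zero) _ _ = cyc-distinct₁₂ (S-ordered x 1 2 (s≤s z≤n) ≤-refl 2<m)
  S-distinct x (suc (suc d)) _ d<m = cyc-distinct₁₃ (S-ordered x 1 (suc (suc d)) (s≤s z≤n) (s≤s (s≤s z≤n)) d<m)

  s-distinct : ∀ i j → toℕ i < toℕ j → s i ≢ s j
  s-distinct i j i<j si≡sj with <-witness i<j
  ... | e , j≡i+1+e = S-distinct (toℕ i) (suc e) (s≤s z≤n) 1+e<m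
      (trans (sym (S-fin i)) (trans si≡sj (trans (S-fin j) (cong S j≡i+1+e))))
    where
    1+e<m : suc e < m
    1+e<m = ≤-<-trans (subst (suc e ≤_) (sym j≡i+1+e) (m≤n+m (suc e) (toℕ i))) (toℕ<n j)

  s-injective : ∀ i j → s i ≡ s j → i ≡ j
  s-injective i j si≡sj with <-cmp (toℕ i) (toℕ j)
  ... | tri< i<j _ _ = ⊥-elim (s-distinct i j i<j si≡sj)
  ... | tri≈ _ i≡j _ = toℕ-injective i≡j
  ... | tri> _ _ j<i = ⊥-elim (s-distinct j i j<i (sym si≡sj))

  S-injective : ∀ x y → S x ≡ S y → x % m ≡ y % m
  S-injective x y Sx≡Sy = trans (sym (toℕ-mod x)) (trans (cong toℕ (s-injective _ _ Sx≡Sy)) (toℕ-mod y))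

  SE : EdgeRel n
  SE = StarEdges k s

  star-end : ∀ x → S (toℕ (x mod m) + k) ≡ S (x + k)
  star-end x = S-shift (toℕ (x mod m)) x k (trans (cong (_% m) (toℕ-mod x)) (m%n%n≡m%n x m))

  star-edge : ∀ x → SE (S x) (S (x + k))
  star-edge x = x mod m , refl , star-end x

  star-in : (E : EdgeRel n) → StarIn k s E → ∀ x → E ∋[ S x , S (x + k) ]
  star-in E inE x = subst (λ z → E ∋[ S x , z ]) (star-end x) (inE (x mod m))

  on-star : ∀ {v y} → SE ∋[ v , y ] → ∃ λ a → v ≡ S a
  on-star (inj₁ (j , sj≡v , _)) = toℕ j , trans (sym sj≡v) (S-fin j)
  on-star (inj₂ (j , _ , sj+k≡v)) = toℕ j + k , sym sj+k≡v

  star-neighbour : ∀ a {y} → SE ∋[ S a , y ] → y ≡ S (a + k) ⊎ y ≡ S (a + suc k)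
  star-neighbour a (inj₁ (j , sj≡Sa , sj+k≡y)) =
    inj₁ (trans (sym sj+k≡y) (S-shift (toℕ j) a k (S-injective (toℕ j) a (trans (sym (S-fin j)) sj≡Sa))))
  star-neighbour a {y} (inj₂ (j , sj≡y , sj+k≡Sa)) = inj₂ (begin
      y  ≡⟨ sym sj≡y ⟩
      s j  ≡⟨ S-fin j ⟩
      S (toℕ j)  ≡⟨ sym (S-around₁ (toℕ j)) ⟩
      S (toℕ j + k + suc k)  ≡⟨ S-shift (toℕ j + k) a (suc k) (S-injective (toℕ j + k) a sj+k≡Sa) ⟩
      S (a + suc k)  ∎)
    where open ≡-Reasoning

  star-angle-shape : ∀ {u v w} → Angle SE u v w → ∃ λ a → v ≡ S a × u ≡ S (a + suc k) × w ≡ S (a + k)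
  star-angle-shape (uvw , uv , vw , _) with on-star vw
  ... | a , refl with star-neighbour a (swap uv) | star-neighbour a vw
  ...   | inj₁ refl | inj₁ refl = ⊥-elim (cyc-irrefl₁₃ uvw)
  ...   | inj₁ refl | inj₂ refl = ⊥-elim (cyc-asym (cyc-rotate (neighbours-ordered a)) uvw)
  ...   | inj₂ refl | inj₁ refl = a , refl , refl , refl
  ...   | inj₂ refl | inj₂ refl = ⊥-elim (cyc-irrefl₁₃ uvw)

  star-angle : ∀ a → Angle SE (S (a + suc k)) (S a) (S (a + k))
  star-angle a = cyc-rotate (cyc-rotate (neighbours-ordered a))
               , inj₁ (subst (SE (S (a + suc k))) (S-around₂ a) (star-edge (a + suc k)))
               , inj₁ (star-edge a)
               , no-bisector
    where
    no-bisector : (t : Fin n) → Cyc (S (a + k)) t (S (a + suc k)) → ¬ (SE ∋[ S a , t ])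
    no-bisector t between edge with star-neighbour a edge
    ... | inj₁ refl = cyc-irrefl₁₂ between
    ... | inj₂ refl = cyc-irrefl₂₃ between

  arc-along : ∀ x d → d < m → d ≤ arc (S x) (S (x + d))
  arc-along x zero _ = z≤n
  arc-along x (suc zero) 1<m = arc-positive (S-distinct x 1 (s≤s z≤n) 1<m)
  arc-along x (suc (suc d)) d+2<m = begin
      suc (suc d)  ≡⟨ +-comm 1 (suc d) ⟩
      suc d + 1  ≤⟨ +-mono-≤ (arc-along x (suc d) (<-trans (n<1+n _) d+2<m)) (arc-positive (cyc-distinct₂₃ step)) ⟩
      arc (S x) (S (x + suc d)) + arc (S (x + suc d)) (S (x + suc (suc d)))  ≡⟨ sym (arc-additive step) ⟩
      arc (S x) (S (x + suc (suc d)))  ∎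
    where
    open ≤-Reasoning
    step : Cyc (S x) (S (x + suc d)) (S (x + suc (suc d)))
    step = S-ordered x (suc d) (suc (suc d)) (s≤s z≤n) (n<1+n _) d+2<m

  -- Both edges of a star angle span k or k+1 star steps either way round, so have length ≥ k.
  star-angle-relevant : ∀ a → RelevantAngle k (S (a + suc k)) (S a) (S (a + k))
  star-angle-relevant a =
      ⊓-glb (subst (λ z → k ≤ arc (S (a + suc k)) z) (S-around₂ a) (arc-along (a + suc k) k k<m))
            (≤-trans (n≤1+n k) (arc-along a (suc k) 1+k<m))
    , ⊓-glb (arc-along a k k<m)
            (≤-trans (n≤1+n k) (subst (λ z → suc k ≤ arc (S (a + k)) z) (S-around₁ a) (arc-along (a + k) (suc k) 1+k<m)))

  star-edges-cross : ∀ x d → 0 < d → d < k → Cross (S x) (S (x + k)) (S (x + d)) (S (x + d + k))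
  star-edges-cross x d 0<d d<k = inj₁
    ( S-ordered x d k 0<d d<k k<m
    , subst₂ (Cyc (S (x + k))) (cong S (regroup x k d)) (S-around₁ x)
        (S-ordered (x + k) d (suc k) 0<d (<-trans d<k (n<1+n k)) 1+k<m))
    where
    regroup : ∀ x k d → x + k + d ≡ x + d + k
    regroup = solve-∀

  -- A chord [S a, t] with t inside the angle ∠(S (a+k+1), S a, S (a+k)), i.e. strictly
  -- between S (a+k) and S (a+k+1), crosses the k star edges [S (a+i+1), S (a+i+1+k)], i < k.
  module Bisector (a : ℕ) (t : Fin n) (between : Cyc (S (a + k)) t (S (a + suc k))) where

    t-beyond-near : Cyc (S a) (S (a + k)) t
    t-beyond-near = cyc-trans′ (cyc-rotate (cyc-rotate (neighbours-ordered a))) (cyc-rotate (cyc-rotate between))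

    t-before-far : Cyc (S a) t (S (a + suc k))
    t-before-far = cyc-rotate (cyc-trans (cyc-rotate (cyc-rotate (neighbours-ordered a))) (cyc-rotate (cyc-rotate between)))

    before-t : ∀ d → 0 < d → d ≤ k → Cyc (S a) (S (a + d)) t
    before-t d 0<d d≤k with d <? k
    ... | yes d<k = cyc-trans (S-ordered a d k 0<d d<k k<m) t-beyond-near
    ... | no d≮k = subst (λ z → Cyc (S a) (S (a + z)) t) (≤-antisym (≮⇒≥ d≮k) d≤k) t-beyond-near

    after-t : ∀ i → i < k → Cyc (S a) t (S (a + suc k + i))
    after-t zero _ = subst (λ z → Cyc (S a) t (S z)) (sym (+-identityʳ (a + suc k))) t-before-far
    after-t (suc i) i+1<k = cyc-trans t-before-far (cyc-rotate (cyc-rotate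
      (subst (Cyc (S (a + suc k)) (S (a + suc k + suc i))) (S-around₂ a)
        (S-ordered (a + suc k) (suc i) k (s≤s z≤n) i+1<k k<m))))

    bisector-crosses : ∀ i → i < k → Cross (S a) t (S (a + suc i)) (S (a + suc i + k))
    bisector-crosses i i<k = inj₁
      ( before-t (suc i) (s≤s z≤n) i<k
      , cyc-rotate (subst (λ z → Cyc (S a) t (S z)) (regroup a k i) (after-t i i<k)))
      where
      regroup : ∀ a k i → a + suc k + i ≡ a + suc i + k
      regroup = solve-∀

    bisector-crossing : (E : EdgeRel n) → StarIn k s E → E ∋[ S a , t ] → HasCrossing (suc k) E
    bisector-crossing E inE at = from , to , edges , crossing
      where
      from to : Fin (suc k) → Fin n
      from fzero = S a
      from (fsuc i) = S (a + suc (toℕ i))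
      to fzero = t
      to (fsuc i) = S (a + suc (toℕ i) + k)

      edges : ∀ i → E ∋[ from i , to i ]
      edges fzero = at
      edges (fsuc i) = star-in E inE (a + suc (toℕ i))

      regroup : ∀ a i d → a + suc i + suc d ≡ a + suc (i + suc d)
      regroup = solve-∀

      later-crosses : ∀ (i j : Fin k) → toℕ i < toℕ j → Cross (from (fsuc i)) (to (fsuc i)) (from (fsuc j)) (to (fsuc j))
      later-crosses i j i<j with <-witness i<j
      ... | d , j≡i+1+d = subst₂ (λ y z → Cross (S (a + suc (toℕ i))) (S (a + suc (toℕ i) + k)) (S y) (S (z + k)))
          offset offset
          (star-edges-cross (a + suc (toℕ i)) (suc d) (s≤s z≤n)
            (≤-<-trans (subst (suc d ≤_) (sym j≡i+1+d) (m≤n+m (suc d) (toℕ i))) (toℕ<n j)))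
        where
        offset : a + suc (toℕ i) + suc d ≡ a + suc (toℕ j)
        offset = trans (regroup a (toℕ i) d) (cong (λ z → a + suc z) (sym j≡i+1+d))

      crossing : ∀ i j → i ≢ j → Cross (from i) (to i) (from j) (to j)
      crossing fzero fzero i≢j = ⊥-elim (i≢j refl)
      crossing fzero (fsuc j) _ = bisector-crosses (toℕ j) (toℕ<n j)
      crossing (fsuc i) fzero _ = cross-sym (bisector-crosses (toℕ i) (toℕ<n i))
      crossing (fsuc i) (fsuc j) i≢j with <-cmp (toℕ i) (toℕ j)
      ... | tri< i<j _ _ = later-crosses i j i<j
      ... | tri≈ _ i≡j _ = ⊥-elim (i≢j (cong fsuc (toℕ-injective i≡j)))
      ... | tri> _ _ j<i = cross-sym (later-crosses j i j<i)

  part1 : (E : EdgeRel n) → CrossingFree (suc k) E → StarIn k s E → Part1 k E s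
  part1 E crossing-free inE u v w angle with star-angle-shape angle
  ... | a , refl , refl , refl =
      (proj₁ angle , far-edge , star-in E inE a , no-bisector) , star-angle-relevant a
    where
    open Bisector a using (bisector-crossing)
    far-edge : E ∋[ S (a + suc k) , S a ]
    far-edge = subst (λ z → E ∋[ S (a + suc k) , z ]) (S-around₂ a) (star-in E inE (a + suc k))
    no-bisector : (t : Fin n) → Cyc (S (a + k)) t (S (a + suc k)) → ¬ (E ∋[ S a , t ])
    no-bisector t between at = crossing-free (bisector-crossing t between E inE at)

  module Gaps (t : Fin n) (outside : (j : Fin m) → s j ≢ t) where

    S≢t : ∀ x → S x ≢ t
    S≢t x = outside (x mod m)

    Gap : ℕ → Set
    Gap i = Cyc (S i) t (S (i + 1))

    below-m : ∀ d e → d + e ≡ 2 * k → d < m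
    below-m d e d+e≡2k = s≤s (subst (d ≤_) d+e≡2k (m≤m+n d e))

    -- Walking on from S d, where S 0 ≺ S d ≺ t, a gap is met before S (2k+1) = S 0.
    gap-from : ∀ e d → d + e ≡ 2 * k → Cyc (S 0) (S d) t → ∃ Gap
    gap-from zero d d+0≡2k S0<Sd<t =
      d , subst (Cyc (S d) t) (sym (S-period 0 (d + 1) d+1≡m)) (cyc-rotate S0<Sd<t)
      where
      d+1≡m : d + 1 ≡ 0 + m
      d+1≡m = trans (+-comm d 1) (cong suc (trans (sym (+-identityʳ d)) d+0≡2k))
    gap-from (suc e) d d+1+e≡2k S0<Sd<t =
      next (cyc-total (S-distinct 0 (suc d) (s≤s z≤n) (below-m (suc d) e d+e+1≡2k)) (S≢t (suc d)) (S≢t 0))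
      where
      d+e+1≡2k : suc d + e ≡ 2 * k
      d+e+1≡2k = trans (sym (+-suc d e)) d+1+e≡2k
      next : Cyc (S 0) (S (suc d)) t ⊎ Cyc (S 0) t (S (suc d)) → ∃ Gap
      next (inj₁ S0<Sd+1<t) = gap-from e (suc d) d+e+1≡2k S0<Sd+1<t
      next (inj₂ S0<t<Sd+1) = d , subst (λ z → Cyc (S d) t (S z)) (+-comm 1 d) (cyc-trans′ S0<Sd<t S0<t<Sd+1)

    gap-exists : ∃ Gap
    gap-exists with cyc-total (S-distinct 0 1 (s≤s z≤n) (<-trans (n<1+n 1) 2<m)) (S≢t 1) (S≢t 0)
    ... | inj₁ S0<S1<t = gap-from (2 * k ∸ 1) 1 (m+[n∸m]≡n (≤-trans k≥1 (m≤m+n k (k + 0)))) S0<S1<t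
    ... | inj₂ S0<t<S1 = 0 , S0<t<S1

    gap-before : ∀ {i} → Gap i → ∀ e → 0 < e → e < m → Cyc (S i) t (S (i + e))
    gap-before gap (suc zero) _ _ = gap
    gap-before {i} gap (suc (suc e)) _ e+2<m = cyc-trans gap (S-ordered i 1 (suc (suc e)) (s≤s z≤n) (s≤s (s≤s z≤n)) e+2<m)

    -- Two distinct gaps would put t on both sides of the chord [S x, S (x+d)].
    no-two-gaps : ∀ x d → 0 < d → d < m → Gap x → Gap (x + d) → ⊥
    no-two-gaps x d 0<d d<m gap₁ gap₂ =
      cyc-asym (gap-before {x} gap₁ d 0<d d<m) (cyc-rotate (cyc-rotate back))
      where
      around : x + d + (m ∸ d) ≡ x + m
      around = trans (+-assoc x d (m ∸ d)) (cong (x +_) (m+[n∸m]≡n (<⇒≤ d<m)))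
      back : Cyc (S (x + d)) t (S x)
      back = subst (Cyc (S (x + d)) t) (S-period x _ around)
        (gap-before {x + d} gap₂ (m ∸ d) (m<n⇒0<n∸m d<m) (∸-monoʳ-< {m} {d} {0} 0<d (<⇒≤ d<m)))

    gap-residue : ∀ p → Gap p → Gap (p % m)
    gap-residue p = subst₂ (λ a b → Cyc a t b) (S-mod p) (S-shift p (p % m) 1 (sym (m%n%n≡m%n p m)))

    residues-apart : ∀ p q → p % m < q % m → Gap p → Gap q → ⊥
    residues-apart p q p<q gap₁ gap₂ with <-witness p<q
    ... | d , q≡p+1+d = no-two-gaps (p % m) (suc d) (s≤s z≤n)
        (≤-<-trans (subst (suc d ≤_) (sym q≡p+1+d) (m≤n+m _ _)) (m%n<n q m))
        (gap-residue p gap₁) (subst Gap q≡p+1+d (gap-residue q gap₂))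

    gap-unique : ∀ p q → Gap p → Gap q → p % m ≡ q % m
    gap-unique p q gap₁ gap₂ with <-cmp (p % m) (q % m)
    ... | tri< p<q _ _ = ⊥-elim (residues-apart p q p<q gap₁ gap₂)
    ... | tri≈ _ p≡q _ = p≡q
    ... | tri> _ _ q<p = ⊥-elim (residues-apart q p q<p gap₂ gap₁)

    bisected-gap : ∀ b → Bisects (S (b + suc k)) (S b) (S (b + k)) t → Gap (b + k)
    bisected-gap b = subst (λ z → Cyc (S (b + k)) t (S z)) (one-more b)

  -- Part 2: the angle of the star bisected by [v, t] is the one at v = S (i + k + 1),
  -- where S i ≺ t ≺ S (i+1) is the gap containing t.
  part2 : Part2 k s
  part2 t outside with Gaps.gap-exists t outside
  ... | i , gap = S (a + suc k) , S a , S (a + k) , (star-angle a , bisects) , unique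
    where
    open Gaps t outside
    a : ℕ
    a = i + suc k
    twice : ∀ i k → i + suc k + suc k ≡ i + 1 + suc (2 * k)
    twice = solve-∀
    bisects : Cyc (S (a + k)) t (S (a + suc k))
    bisects = subst₂ (λ x y → Cyc x t y) (sym (S-around₂ i)) (sym (S-period (i + 1) _ (twice i k))) gap
    unique : (u′ v′ w′ : Fin n) → Angle SE u′ v′ w′ → Bisects u′ v′ w′ t →
             u′ ≡ S (a + suc k) × v′ ≡ S a × w′ ≡ S (a + k)
    unique u′ v′ w′ angle bisects′ with star-angle-shape angle
    ... | b , refl , refl , refl =
        (begin
          S (b + suc k)  ≡⟨ cong S (one-more b) ⟩
          S (b + k + 1)  ≡⟨ S-shift (b + k) (a + k) 1 same-gap ⟩
          S (a + k + 1)  ≡⟨ cong S (sym (one-more a)) ⟩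
          S (a + suc k)  ∎)
      , (begin
          S b  ≡⟨ sym (S-around₁ b) ⟩
          S (b + k + suc k)  ≡⟨ S-shift (b + k) (a + k) (suc k) same-gap ⟩
          S (a + k + suc k)  ≡⟨ S-around₁ a ⟩
          S a  ∎)
      , S-cong (b + k) (a + k) same-gap
      where
      open ≡-Reasoning
      same-gap : (b + k) % m ≡ (a + k) % m
      same-gap = gap-unique (b + k) (a + k) (bisected-gap b bisects′) (bisected-gap a bisects)

-- Lemma 3.1.  For k = 0 the star edge [s₀, s₀] would be a loop; for k ≥ 1 both
-- parts are the lemmas part1 and part2 of the star module.
lemma3p1 : (n k : ℕ) → suc (2 * k) ≤ n → (E : EdgeRel n) → Loopless E →
    CrossingFree (suc k) E →
    (R S : Fin (suc (2 * k)) → Fin n) →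
    CyclicChain R → StarIn k R E → CyclicChain S → StarIn k S E →
    (Part1 k E S × Part1 k E R) × Part2 k S
lemma3p1 n zero _ E loopless _ R S _ _ _ S-in-E = ⊥-elim (no-loop (S-in-E fzero))
  where
  no-loop : E ∋[ S fzero , S fzero ] → ⊥
  no-loop (inj₁ loop) = loopless _ loop
  no-loop (inj₂ loop) = loopless _ loop
lemma3p1 n (suc k) _ E _ crossing-free R S R-chain R-in-E S-chain S-in-E =
  ( Star.part1 (suc k) S S-chain (s≤s z≤n) E crossing-free S-in-E
  , Star.part1 (suc k) R R-chain (s≤s z≤n) E crossing-free R-in-E )
  , Star.part2 (suc k) S S-chain (s≤s z≤n)
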